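{- For every $n\geq 2$, $\kappa^s(BH_n;K_{1,2})=n$.
   Context: The $n$-dimensional balanced hypercube $BH_n$ is the graph with vertex set $\{0,1,2,3\}^n$, vertices written $(a_0,a_1,\dots,a_{n-1})$, in which $(a_0,\dots,a_{n-1})$ is adjacent exactly to the $2n$ vertices $((a_0\pm 1)\bmod 4,a_1,\dots,a_{n-1})$ and, for each $1\le i\le n-1$, $((a_0\pm1)\bmod 4,a_1,\dots,a_{i-1},(a_i+(-1)^{a_0})\bmod 4,a_{i+1},\dots,a_{n-1})$. For a connected graph $G$ and a set $F$ of connected subgraphs of $G$, let $V(F)$ be the union of their vertex sets; $F$ is a subgraph-cut if $G-V(F)$ is disconnected or trivial. For a connected subgraph $H$ of $G$, an $H$-substructure-cut is a subgraph-cut each of whose elements is isomorphic to a connected subgraph of $H$, and $\kappa^s(G;H)$ is the minimum cardinality of an $H$-substructure-cut. $K_{1,2}$ is the star with two leaves (a path on three vertices). -}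

module Defs where

open import Data.Nat using (ℕ; _≤_)
open import Data.Fin using (Fin; zero; suc)
open import Data.Vec using (Vec; []; _∷_; updateAt)
open import Data.List using (List; length)
open import Data.List.Relation.Unary.Any using (Any)
open import Data.Product using (Σ; ∃; _×_; _,_)
open import Data.Sum using (_⊎_)
open import Relation.Nullary using (¬_)
open import Relation.Binary.PropositionalEquality using (_≡_; _≢_)

inc4 : Fin 4 → Fin 4
inc4 zero = suc zero
inc4 (suc zero) = suc (suc zero)
inc4 (suc (suc zero)) = suc (suc (suc zero))
inc4 (suc (suc (suc zero))) = zero

dec4 : Fin 4 → Fin 4
dec4 zero = suc (suc (suc zero))
dec4 (suc zero) = zero
dec4 (suc (suc zero)) = suc zero
dec4 (suc (suc (suc zero))) = suc (suc zero)

twist : Fin 4 → Fin 4 → Fin 4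
twist zero = inc4
twist (suc zero) = dec4
twist (suc (suc zero)) = inc4
twist (suc (suc (suc zero))) = dec4

PM : Fin 4 → Fin 4 → Set
PM a b = (b ≡ inc4 a) ⊎ (b ≡ dec4 a)

-- Vertices of BH_n: (a_0, a_1, ..., a_{n-1}) ∈ {0,1,2,3}^n, a_0 is the head.
Vertex : ℕ → Set
Vertex n = Vec (Fin 4) n

-- Adjacency of the balanced hypercube BH_n.
-- inner: ((a_0 ± 1) mod 4, a_1, ..., a_{n-1})
-- outer i: ((a_0 ± 1) mod 4, a_1, ..., (a_{i+1} + (-1)^{a_0}) mod 4, ...)
--   (i : Fin (n-1) indexes a_1 .. a_{n-1})
data Adj : {n : ℕ} → Vertex n → Vertex n → Set where
  inner : {m : ℕ} {a b : Fin 4} {as : Vec (Fin 4) m} →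
          PM a b → Adj (a ∷ as) (b ∷ as)
  outer : {m : ℕ} {a b : Fin 4} {as : Vec (Fin 4) m} (i : Fin m) →
          PM a b → Adj (a ∷ as) (b ∷ updateAt as i (twist a))

-- Connected subgraphs of BH_n isomorphic to a connected subgraph of K_{1,2}:
-- up to isomorphism these are K_1, K_2 and K_{1,2} (= path on 3 vertices).
data K12Sub (n : ℕ) : Set where
  k1  : Vertex n → K12Sub n
  k2  : (u v : Vertex n) → Adj u v → K12Sub n
  k12 : (u v w : Vertex n) → Adj u v → Adj v w → u ≢ w → K12Sub n

data InSub {n : ℕ} : Vertex n → K12Sub n → Set where
  in-k1   : ∀ {u} → InSub u (k1 u)
  in-k2₁  : ∀ {u v e} → InSub u (k2 u v e)
  in-k2₂  : ∀ {u v e} → InSub v (k2 u v e)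
  in-k12₁ : ∀ {u v w e f d} → InSub u (k12 u v w e f d)
  in-k12₂ : ∀ {u v w e f d} → InSub v (k12 u v w e f d)
  in-k12₃ : ∀ {u v w e f d} → InSub w (k12 u v w e f d)

InV : {n : ℕ} → Vertex n → List (K12Sub n) → Set
InV v F = Any (InSub v) F

data Reach {n : ℕ} (F : List (K12Sub n)) : Vertex n → Vertex n → Set where
  here : ∀ {u} → ¬ InV u F → Reach F u u
  step : ∀ {u w v} → ¬ InV u F → Adj u w → Reach F w v → Reach F u v

Disconnected : {n : ℕ} → List (K12Sub n) → Set
Disconnected {n} F = Σ (Vertex n) λ u → Σ (Vertex n) λ v →
  ¬ InV u F × ¬ InV v F × ¬ Reach F u v

Trivial : {n : ℕ} → List (K12Sub n) → Set
Trivial {n} F = Σ (Vertex n) λ u → ¬ InV u F × (∀ v → ¬ InV v F → v ≡ u)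

IsK12Cut : {n : ℕ} → List (K12Sub n) → Set
IsK12Cut F = Disconnected F ⊎ Trivial F

KappaS-K12-BH : ℕ → ℕ → Set
KappaS-K12-BH n k =
  (Σ (List (K12Sub n)) λ F → IsK12Cut F × length F ≡ k) ×
  (∀ (F : List (K12Sub n)) → IsK12Cut F → k ≤ length F)

module Submission where

open import Data.Nat using (ℕ; zero; suc; _+_; _*_; _^_; _≤_; _<_; z≤n; s≤s; _≤?_)
open import Data.Nat.Properties
open import Data.Nat.ListAction using (sum)
open import Data.Nat.Tactic.RingSolver using (solve-∀)
open import Data.Bool using (Bool; true; false; _∧_; _∨_; not)
import Data.Bool.Properties as Bool
open import Data.Fin using (Fin; zero; suc)
import Data.Fin as Fin
open import Data.Vec using (Vec; []; _∷_; updateAt; replicate)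
open import Data.Vec.Properties
  using (∷-injective; ∷-injectiveˡ; ∷-injectiveʳ; updateAt-updateAt-local; updateAt-id; ≡-dec)
open import Data.List using (List; []; _∷_; _++_; map; length; concatMap; cartesianProductWith; allFin)
open import Data.List.Properties using (length-++; length-map; length-tabulate)
open import Data.List.Relation.Unary.Any using (here; there; any?)
open import Data.List.Relation.Unary.All using (All; []; _∷_; lookup)
open import Data.List.Relation.Unary.AllPairs using ([]; _∷_)
open import Data.List.Relation.Unary.Unique.Propositional using (Unique)
open import Data.List.Relation.Unary.Unique.Propositional.Properties
  using (cartesianProductWith⁺; allFin⁺; map⁺; ++⁺)
open import Data.List.Membership.Propositional using (_∈_)
open import Data.List.Membership.Propositional.Properties
  using (∈-∃++; ∈-++⁻; ∈-++⁺ˡ; ∈-++⁺ʳ; ∈-map⁻; ∈-map⁺; ∈-allFin; ∈-cartesianProductWith⁺)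
open import Data.Product using (Σ; ∃; _×_; _,_; proj₁; proj₂)
open import Data.Sum using (_⊎_; inj₁; inj₂)
open import Data.Empty using (⊥; ⊥-elim)
open import Relation.Nullary using (¬_; Dec; yes; no; does)
open import Relation.Nullary.Decidable using (_×-dec_)
open import Relation.Binary.PropositionalEquality
open import Algebra.Properties.CommutativeSemigroup +-commutativeSemigroup
  using () renaming (interchange to +-interchange; x∙yz≈y∙xz to +-left-swap)
open import Defs

-- Upper bound (module Isolation): the n neighbours of o = (0,0,…,0) are the
-- vertices (1,x), (3,x) for n tails x, and the paths (1,x) - (2,x) - (3,x)
-- cut o off from the rest of the graph.
--
-- Write n = L + 1.  The vertices (a,x) and (a+2,x) are twins
-- (same neighbourhood), so BH_n is a blow-up of a quotient graph Q_L on pairs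
-- (parity, tail); a quotient vertex dies when both twins are deleted.
--  * quotient-connected: if at most L dead vertices have each parity and at
--    most 2L - 1 are dead altogether, the rest of Q_L is connected.  Induction
--    on L: Q_{L+1} is four copies of Q_L, at most one of which violates the
--    hypothesis, and the living vertices of that copy escape to the others.
--  * SmallFamily: a K_{1,2} has at most 2 vertices of each parity and 3 in
--    all, so fewer than n subgraphs kill at most L quotient vertices of each
--    parity and ⌊3L/2⌋ ≤ 2L - 1 in total; quotient paths lift back to BH_n,
--    which therefore stays connected with survivors of both parities.

b2n : Bool → ℕ
b2n true = 1
b2n false = 0

b2n≤1 : ∀ b → b2n b ≤ 1
b2n≤1 true = ≤-refl
b2n≤1 false = z≤n

count : ∀ {A : Set} → (A → Bool) → List A → ℕ
count g [] = 0
count g (x ∷ xs) = b2n (g x) + count g xs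

module _ {A : Set} where

  count-++ : ∀ (g : A → Bool) xs ys → count g (xs ++ ys) ≡ count g xs + count g ys
  count-++ g [] ys = refl
  count-++ g (x ∷ xs) ys = trans (cong (b2n (g x) +_) (count-++ g xs ys)) (sym (+-assoc (b2n (g x)) _ _))

  count-map : ∀ {B : Set} (g : B → Bool) (f : A → B) xs → count g (map f xs) ≡ count (λ x → g (f x)) xs
  count-map g f [] = refl
  count-map g f (x ∷ xs) = cong (b2n (g (f x)) +_) (count-map g f xs)

  count≤length : ∀ (g : A → Bool) xs → count g xs ≤ length xs
  count≤length g [] = z≤n
  count≤length g (x ∷ xs) = +-mono-≤ (b2n≤1 (g x)) (count≤length g xs)

  count-mono : ∀ (g h : A → Bool) → (∀ x → b2n (g x) ≤ b2n (h x)) → ∀ xs → count g xs ≤ count h xs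
  count-mono g h le [] = z≤n
  count-mono g h le (x ∷ xs) = +-mono-≤ (le x) (count-mono g h le xs)

  count-∨ : ∀ (g h : A → Bool) xs → count (λ x → g x ∨ h x) xs ≤ count g xs + count h xs
  count-∨ g h [] = z≤n
  count-∨ g h (x ∷ xs) = begin
      b2n (g x ∨ h x) + count (λ y → g y ∨ h y) xs
        ≤⟨ +-mono-≤ (b2n-∨ (g x) (h x)) (count-∨ g h xs) ⟩
      (b2n (g x) + b2n (h x)) + (count g xs + count h xs)
        ≡⟨ +-interchange (b2n (g x)) (b2n (h x)) (count g xs) (count h xs) ⟩
      (b2n (g x) + count g xs) + (b2n (h x) + count h xs) ∎
    where
    open ≤-Reasoning
    b2n-∨ : ∀ a b → b2n (a ∨ b) ≤ b2n a + b2n b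
    b2n-∨ true b = s≤s z≤n
    b2n-∨ false b = ≤-refl

  find-false : ∀ (g : A → Bool) xs → (∃ λ x → x ∈ xs × g x ≡ false) ⊎ (length xs ≤ count g xs)
  find-false g [] = inj₂ z≤n
  find-false g (x ∷ xs) with g x in gx | find-false g xs
  ... | false | _ = inj₁ (x , here refl , gx)
  ... | true  | inj₁ (y , y∈ , gy) = inj₁ (y , there y∈ , gy)
  ... | true  | inj₂ all = inj₂ (s≤s all)

  count-pos : ∀ (g : A → Bool) {x} xs → x ∈ xs → g x ≡ true → 1 ≤ count g xs
  count-pos g (y ∷ xs) (here refl) gx rewrite gx = s≤s z≤n
  count-pos g (y ∷ xs) (there x∈) gx = ≤-trans (count-pos g xs x∈ gx) (m≤n+m _ _)

  count-extract : ∀ (h : A → Bool) {x} ys₁ ys₂ →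
                  count h (ys₁ ++ x ∷ ys₂) ≡ b2n (h x) + count h (ys₁ ++ ys₂)
  count-extract h [] ys₂ = refl
  count-extract h {x} (y ∷ ys₁) ys₂ =
    trans (cong (b2n (h y) +_) (count-extract h ys₁ ys₂)) (+-left-swap (b2n (h y)) (b2n (h x)) _)

  ∈-remove : ∀ {x y : A} ys₁ ys₂ → y ∈ ys₁ ++ x ∷ ys₂ → y ≢ x → y ∈ ys₁ ++ ys₂
  ∈-remove ys₁ ys₂ y∈ y≢x with ∈-++⁻ ys₁ y∈
  ... | inj₁ p = ∈-++⁺ˡ p
  ... | inj₂ (here y≡x) = ⊥-elim (y≢x y≡x)
  ... | inj₂ (there p) = ∈-++⁺ʳ ys₁ p

  count-embed : ∀ (g h : A → Bool) {xs ys} → Unique xs →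
                (∀ {x} → x ∈ xs → g x ≡ true → x ∈ ys × h x ≡ true) →
                count g xs ≤ count h ys
  count-embed g h {[]} _ _ = z≤n
  count-embed g h {x ∷ xs} (x∉xs ∷ uniq) emb with g x in gx
  ... | false = count-embed g h uniq (λ y∈ → emb (there y∈))
  ... | true with emb (here refl) gx
  ...   | x∈ys , hx with ∈-∃++ x∈ys
  ...     | ys₁ , ys₂ , refl = begin
      1 + count g xs                    ≤⟨ s≤s (count-embed g h uniq emb′) ⟩
      1 + count h (ys₁ ++ ys₂)          ≡⟨ cong (λ b → b2n b + count h (ys₁ ++ ys₂)) (sym hx) ⟩
      b2n (h x) + count h (ys₁ ++ ys₂)  ≡⟨ sym (count-extract h ys₁ ys₂) ⟩
      count h (ys₁ ++ x ∷ ys₂)          ∎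
    where
    open ≤-Reasoning
    emb′ : ∀ {y} → y ∈ xs → g y ≡ true → y ∈ ys₁ ++ ys₂ × h y ≡ true
    emb′ y∈ gy with emb (there y∈) gy
    ... | y∈ys , hy = ∈-remove ys₁ ys₂ y∈ys (≢-sym (lookup x∉xs y∈)) , hy

pattern one   = suc zero
pattern two   = suc (suc zero)
pattern three = suc (suc (suc zero))

inc-dec : ∀ c → inc4 (dec4 c) ≡ c
inc-dec zero  = refl
inc-dec one   = refl
inc-dec two   = refl
inc-dec three = refl

dec-inc : ∀ c → dec4 (inc4 c) ≡ c
dec-inc zero  = refl
dec-inc one   = refl
dec-inc two   = refl
dec-inc three = refl

inc³≡dec : ∀ c → inc4 (inc4 (inc4 c)) ≡ dec4 c
inc³≡dec zero  = refl
inc³≡dec one   = refl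
inc³≡dec two   = refl
inc³≡dec three = refl

inc-nofix : ∀ c → inc4 c ≢ c
inc-nofix zero  ()
inc-nofix one   ()
inc-nofix two   ()
inc-nofix three ()

dec-nofix : ∀ c → dec4 c ≢ c
dec-nofix zero  ()
dec-nofix one   ()
dec-nofix two   ()
dec-nofix three ()

inc≢dec : ∀ c → inc4 c ≢ dec4 c
inc≢dec zero  ()
inc≢dec one   ()
inc≢dec two   ()
inc≢dec three ()

position : ∀ (c c' : Fin 4) → (c' ≡ c) ⊎ (c' ≡ inc4 c) ⊎ (c' ≡ inc4 (inc4 c)) ⊎ (c' ≡ dec4 c)
position zero  zero  = inj₁ refl
position zero  one   = inj₂ (inj₁ refl)
position zero  two   = inj₂ (inj₂ (inj₁ refl))
position zero  three = inj₂ (inj₂ (inj₂ refl))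
position one   zero  = inj₂ (inj₂ (inj₂ refl))
position one   one   = inj₁ refl
position one   two   = inj₂ (inj₁ refl)
position one   three = inj₂ (inj₂ (inj₁ refl))
position two   zero  = inj₂ (inj₂ (inj₁ refl))
position two   one   = inj₂ (inj₂ (inj₂ refl))
position two   two   = inj₁ refl
position two   three = inj₂ (inj₁ refl)
position three zero  = inj₂ (inj₁ refl)
position three one   = inj₂ (inj₂ (inj₁ refl))
position three two   = inj₂ (inj₂ (inj₂ refl))
position three three = inj₁ refl

-- Words of length L over ℤ₄ (the tails a₁ … a_L of vertices of BH_{L+1}).
Word : ℕ → Set
Word L = Vec (Fin 4) L

words : ∀ L → List (Word L)
words zero = [] ∷ []
words (suc L) = cartesianProductWith _∷_ (allFin 4) (words L)

words-unique : ∀ L → Unique (words L)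
words-unique zero = [] ∷ []
words-unique (suc L) = cartesianProductWith⁺ _∷_ ∷-injective (allFin⁺ 4) (words-unique L)

∈-words : ∀ {L} (x : Word L) → x ∈ words L
∈-words [] = here refl
∈-words (a ∷ x) = ∈-cartesianProductWith⁺ _∷_ (∈-allFin a) (∈-words x)

length-cartesianProductWith : ∀ {A B C : Set} (f : A → B → C) xs ys →
  length (cartesianProductWith f xs ys) ≡ length xs * length ys
length-cartesianProductWith f [] ys = refl
length-cartesianProductWith f (x ∷ xs) ys =
  trans (length-++ (map (f x) ys)) (cong₂ _+_ (length-map (f x) ys) (length-cartesianProductWith f xs ys))

length-words : ∀ L → length (words L) ≡ 4 ^ L
length-words zero = refl
length-words (suc L) =
  trans (length-cartesianProductWith _∷_ (allFin 4) (words L)) (cong (4 *_) (length-words L))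

2L<4^L : ∀ L → suc (L + L) ≤ 4 ^ L
2L<4^L zero = ≤-refl
2L<4^L (suc L) = begin
  suc (suc L + suc L)                 ≤⟨ m≤n+m _ (suc (6 * L)) ⟩
  suc (6 * L) + suc (suc L + suc L)   ≡⟨ ring L ⟩
  4 * suc (L + L)                     ≤⟨ *-monoʳ-≤ 4 (2L<4^L L) ⟩
  4 * 4 ^ L                           ∎
  where
  open ≤-Reasoning
  ring : ∀ L → suc (6 * L) + suc (suc L + suc L) ≡ 4 * suc (L + L)
  ring = solve-∀

words-large : ∀ L → suc (L + L) ≤ length (words L)
words-large L = ≤-trans (2L<4^L L) (≤-reflexive (sym (length-words L)))

updateAt-inverse : ∀ {L} {f g : Fin 4 → Fin 4} → (∀ c → f (g c) ≡ c) →
                   (x : Word L) (i : Fin L) → updateAt (updateAt x i g) i f ≡ x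
updateAt-inverse inv x i = trans (updateAt-updateAt-local i x (inv _)) (updateAt-id i x)

updateAt-moves : ∀ {L} (f : Fin 4 → Fin 4) → (∀ c → f c ≢ c) →
                 (x : Word L) (i : Fin L) → updateAt x i f ≢ x
updateAt-moves f nofix (a ∷ x) zero e = nofix a (∷-injectiveˡ e)
updateAt-moves f nofix (a ∷ x) (suc i) e = updateAt-moves f nofix x i (∷-injectiveʳ e)

updateAt-injective : ∀ {L} (f : Fin 4 → Fin 4) → (∀ c → f c ≢ c) → (x : Word L) →
                     ∀ {i j} → updateAt x i f ≡ updateAt x j f → i ≡ j
updateAt-injective f nofix (a ∷ x) {zero} {zero} e = refl
updateAt-injective f nofix (a ∷ x) {zero} {suc j} e = ⊥-elim (nofix a (∷-injectiveˡ e))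
updateAt-injective f nofix (a ∷ x) {suc i} {zero} e = ⊥-elim (nofix a (sym (∷-injectiveˡ e)))
updateAt-injective f nofix (a ∷ x) {suc i} {suc j} e =
  cong suc (updateAt-injective f nofix x (∷-injectiveʳ e))

-- The L + 1 words x, x + f e₀, …, x + f e_{L-1}: the tails of the neighbours of
-- a vertex with tail x inside one parity class.
star : ∀ {L} (f : Fin 4 → Fin 4) → Word L → List (Word L)
star {L} f x = x ∷ map (λ i → updateAt x i f) (allFin L)

star-unique : ∀ {L} (f : Fin 4 → Fin 4) → (∀ c → f c ≢ c) → (x : Word L) → Unique (star f x)
star-unique {L} f nofix x = centre-fresh (allFin L) ∷ map⁺ (updateAt-injective f nofix x) (allFin⁺ L)
  where
  centre-fresh : ∀ is → All (x ≢_) (map (λ i → updateAt x i f) is)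
  centre-fresh [] = []
  centre-fresh (i ∷ is) = (λ e → updateAt-moves f nofix x i (sym e)) ∷ centre-fresh is

length-star : ∀ {L} (f : Fin 4 → Fin 4) (x : Word L) → length (star f x) ≡ suc L
length-star {L} f x = cong suc (trans (length-map _ (allFin L)) (length-tabulate {n = L} (λ i → i)))

blocks-unique : ∀ {L} {c c' : Fin 4} → c ≢ c' →
                Unique (map (c ∷_) (words L) ++ map (c' ∷_) (words L))
blocks-unique {L} {c} {c'} c≢c' =
  ++⁺ (map⁺ ∷-injectiveʳ (words-unique L)) (map⁺ ∷-injectiveʳ (words-unique L)) disjoint
  where
  disjoint : ∀ {x} → ¬ (x ∈ map (c ∷_) (words L) × x ∈ map (c' ∷_) (words L))
  disjoint (x∈c , x∈c') with ∈-map⁻ (c ∷_) x∈c | ∈-map⁻ (c' ∷_) x∈c'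
  ... | _ , _ , refl | _ , _ , e = c≢c' (∷-injectiveˡ e)

count-words-suc : ∀ {L} (g : Word (suc L) → Bool) →
  count g (words (suc L)) ≡ sum (map (λ c → count (λ x → g (c ∷ x)) (words L)) (allFin 4))
count-words-suc {L} g = by-blocks (allFin 4)
  where
  by-blocks : ∀ cs → count g (cartesianProductWith _∷_ cs (words L)) ≡
                     sum (map (λ c → count (λ x → g (c ∷ x)) (words L)) cs)
  by-blocks [] = refl
  by-blocks (c ∷ cs) =
    trans (count-++ g (map (c ∷_) (words L)) _) (cong₂ _+_ (count-map g (c ∷_) (words L)) (by-blocks cs))

count-blocks : ∀ {L} (g : Word (suc L) → Bool) (c c' : Fin 4) →
  count g (map (c ∷_) (words L) ++ map (c' ∷_) (words L)) ≡
  count (λ x → g (c ∷ x)) (words L) + count (λ x → g (c' ∷ x)) (words L)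
count-blocks {L} g c c' =
  trans (count-++ g (map (c ∷_) (words L)) _)
        (cong₂ _+_ (count-map g (c ∷_) (words L)) (count-map g (c' ∷_) (words L)))

-- The vertex (false , x) stands for the twins
-- (0,x) and (2,x) of BH_{L+1}, the vertex (true , x) for (1,x) and (3,x):
-- twins have the same neighbourhood, and Q_L records the adjacencies.
QV : ℕ → Set
QV L = Bool × Word L

data QAdj {L} : QV L → QV L → Set where
  flat   : ∀ {x} → QAdj (false , x) (true , x)
  shift  : ∀ {x} (i : Fin L) → QAdj (false , x) (true , updateAt x i inc4)
  flat˘  : ∀ {x} → QAdj (true , x) (false , x)
  shift˘ : ∀ {x} (i : Fin L) → QAdj (true , updateAt x i inc4) (false , x)

QAdj-sym : ∀ {L} {X Y : QV L} → QAdj X Y → QAdj Y X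
QAdj-sym flat = flat˘
QAdj-sym (shift i) = shift˘ i
QAdj-sym flat˘ = flat
QAdj-sym (shift˘ i) = shift i

-- A deletion pattern d marks the dead quotient vertices (d X ≡ true);
-- QPath d X Y is a walk from X to Y through living vertices only.
module _ {L} (d : QV L → Bool) where

  data QPath : QV L → QV L → Set where
    stop : ∀ {X} → d X ≡ false → QPath X X
    move : ∀ {X Y Z} → d X ≡ false → QAdj X Y → QPath Y Z → QPath X Z

  QPath-start : ∀ {X Y} → QPath X Y → d X ≡ false
  QPath-start (stop a) = a
  QPath-start (move a _ _) = a

  QPath-trans : ∀ {X Y Z} → QPath X Y → QPath Y Z → QPath X Z
  QPath-trans (stop _) q = q
  QPath-trans (move a e p) q = move a e (QPath-trans p q)

  QPath-sym : ∀ {X Y} → QPath X Y → QPath Y X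
  QPath-sym (stop a) = stop a
  QPath-sym (move a e p) = QPath-trans (QPath-sym p) (move (QPath-start p) (QAdj-sym e) (stop a))

  Connected : Set
  Connected = ∀ X Y → d X ≡ false → d Y ≡ false → QPath X Y

dead : ∀ {L} → Bool → (QV L → Bool) → ℕ
dead {L} p d = count (λ x → d (p , x)) (words L)

-- 2L - 1, truncated at 0.
slack : ℕ → ℕ
slack zero = 0
slack (suc m) = suc (m + m)

Sparse : ∀ L → (QV L → Bool) → Set
Sparse L d = dead false d ≤ L × dead true d ≤ L × dead false d + dead true d ≤ slack L

sparse? : ∀ L d → Dec (Sparse L d)
sparse? L d = (_ ≤? L) ×-dec ((_ ≤? L) ×-dec (_ ≤? slack L))

not-sparse : ∀ L d {x} → ¬ Sparse L d → dead false d + dead true d + x ≤ suc (L + L) →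
  (suc L ≤ dead false d ⊎ suc L ≤ dead true d ⊎ x ≤ 1) × suc L ≤ dead false d + dead true d
not-sparse L d {x} ¬sparse room
  with dead false d ≤? L | dead true d ≤? L | dead false d + dead true d ≤? slack L
... | no E≰L | _ | _ = inj₁ (≰⇒> E≰L) , ≤-trans (≰⇒> E≰L) (m≤m+n _ _)
... | yes _ | no O≰L | _ = inj₂ (inj₁ (≰⇒> O≰L)) , ≤-trans (≰⇒> O≰L) (m≤n+m _ _)
... | yes E≤L | yes O≤L | yes T≤ = ⊥-elim (¬sparse (E≤L , O≤L , T≤))
... | yes _ | yes _ | no T≰ =
  inj₂ (inj₂ (+-cancelˡ-≤ (L + L) x 1 (begin
      L + L + x                          ≤⟨ +-monoˡ-≤ x (double≤ L) ⟩
      suc (slack L) + x                  ≤⟨ +-monoˡ-≤ x (≰⇒> T≰) ⟩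
      dead false d + dead true d + x     ≤⟨ room ⟩
      suc (L + L)                        ≡⟨ +-comm 1 (L + L) ⟩
      L + L + 1                          ∎))) ,
  ≤-trans (s≤s (slack≥ L)) (≰⇒> T≰)
  where
  open ≤-Reasoning
  slack≥ : ∀ L → L ≤ slack L
  slack≥ zero = z≤n
  slack≥ (suc m) = s≤s (m≤m+n m m)
  double≤ : ∀ L → L + L ≤ suc (slack L)
  double≤ zero = z≤n
  double≤ (suc m) = s≤s (≤-reflexive (+-suc m m))

-- Q_{L+1} consists of four copies of Q_L, one for each value c of the first
-- tail coordinate; copy c is joined to copy c + 1 by the edges
-- (false , c ∷ x) — (true , c + 1 ∷ x).
embed : ∀ {L} → Fin 4 → QV L → QV (suc L)
embed c (p , x) = p , c ∷ x

copy : ∀ {L} → Fin 4 → (QV (suc L) → Bool) → QV L → Bool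
copy c d X = d (embed c X)

embed-adj : ∀ {L} c {X Y : QV L} → QAdj X Y → QAdj (embed c X) (embed c Y)
embed-adj c flat = flat
embed-adj c (shift i) = shift (suc i)
embed-adj c flat˘ = flat˘
embed-adj c (shift˘ i) = shift˘ (suc i)

embed-path : ∀ {L} c (d : QV (suc L) → Bool) {X Y} →
             QPath (copy c d) X Y → QPath d (embed c X) (embed c Y)
embed-path c d (stop a) = stop a
embed-path c d (move a e p) = move a (embed-adj c e) (embed-path c d p)

cross : ∀ {L} c {x : Word L} → QAdj (false , c ∷ x) (true , inc4 c ∷ x)
cross c = shift zero

cross˘ : ∀ {L} c {x : Word L} → QAdj (true , c ∷ x) (false , dec4 c ∷ x)
cross˘ c {x} = subst (λ a → QAdj (true , a ∷ x) (false , dec4 c ∷ x)) (inc-dec c) (shift˘ zero)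

dead-copies : ∀ {L} p (d : QV (suc L) → Bool) {c c'} → c ≢ c' →
              dead p (copy c d) + dead p (copy c' d) ≤ dead p d
dead-copies {L} p d {c} {c'} c≢c' = begin
  dead p (copy c d) + dead p (copy c' d)
    ≡⟨ sym (count-blocks g c c') ⟩
  count g (map (c ∷_) (words L) ++ map (c' ∷_) (words L))
    ≤⟨ count-embed g g (blocks-unique c≢c') (λ {x} _ dx → ∈-words x , dx) ⟩
  dead p d ∎
  where
  open ≤-Reasoning
  g : Word (suc L) → Bool
  g x = d (p , x)

∨-false : ∀ {a b} → (a ∨ b) ≡ false → a ≡ false × b ≡ false
∨-false {false} b≡false = refl , b≡false

+-≤-zero : ∀ {k a b} → k ≤ a → a + b ≤ k → b ≡ 0
+-≤-zero {k} {a} {b} k≤a a+b≤k =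
  n≤0⇒n≡0 (+-cancelˡ-≤ a b 0 (≤-trans a+b≤k (≤-trans k≤a (≤-reflexive (sym (+-identityʳ a))))))

no-room : ∀ {k a b} → k ≤ a → 1 ≤ b → a + b ≤ k → ⊥
no-room k≤a 1≤b a+b≤k with +-≤-zero k≤a a+b≤k
no-room k≤a () a+b≤k | refl

drop-zero : ∀ {k a b} → k ≤ a + b → b ≡ 0 → k ≤ a
drop-zero {a = a} k≤a+b refl = ≤-trans k≤a+b (≤-reflexive (+-identityʳ a))

Q₀-connected : ∀ (d : QV 0 → Bool) → Connected d
Q₀-connected d (false , []) (false , []) a _ = stop a
Q₀-connected d (false , []) (true , []) a b = move a flat (stop b)
Q₀-connected d (true , []) (false , []) a b = move a flat˘ (stop b)
Q₀-connected d (true , []) (true , []) a _ = stop a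

module Step {m} (IH : ∀ d → Sparse m d → Connected d)
                (d : QV (suc m) → Bool) (sparse : Sparse (suc m) d) where

  E O : Fin 4 → ℕ
  E c = dead false (copy c d)
  O c = dead true (copy c d)

  Good : Fin 4 → Set
  Good c = Sparse m (copy c d)

  E-pair : ∀ {c c'} → c ≢ c' → E c + E c' ≤ suc m
  E-pair c≢c' = ≤-trans (dead-copies false d c≢c') (proj₁ sparse)

  O-pair : ∀ {c c'} → c ≢ c' → O c + O c' ≤ suc m
  O-pair c≢c' = ≤-trans (dead-copies true d c≢c') (proj₁ (proj₂ sparse))

  EO-pair : ∀ {c c' c'' c'''} → c ≢ c' → c'' ≢ c''' →
            (E c + O c'') + (E c' + O c''') ≤ suc (m + m)
  EO-pair {c} {c'} {c''} {c'''} c≢c' c''≢c''' = begin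
    (E c + O c'') + (E c' + O c''') ≡⟨ +-interchange (E c) (O c'') (E c') (O c''') ⟩
    (E c + E c') + (O c'' + O c''') ≤⟨ +-mono-≤ (dead-copies false d c≢c') (dead-copies true d c''≢c''') ⟩
    dead false d + dead true d      ≤⟨ proj₂ (proj₂ sparse) ⟩
    suc (m + m)                     ∎
    where open ≤-Reasoning

  c≢c+1 : ∀ c → c ≢ inc4 c
  c≢c+1 c e = inc-nofix c (sym e)

  c≢c-1 : ∀ c → c ≢ dec4 c
  c≢c-1 c e = dec-nofix c (sym e)

  bad : ∀ c → ¬ Good c →
        (suc m ≤ E c ⊎ suc m ≤ O c ⊎ E (dec4 c) + O (inc4 c) ≤ 1) × suc m ≤ E c + O c
  bad c ¬good = not-sparse m (copy c d) ¬good (EO-pair (c≢c-1 c) (c≢c+1 c))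

  -- At most one copy is bad: two bad copies would hold 2m + 2 dead vertices.
  one-bad : ∀ {c c'} → ¬ Good c → ¬ Good c' → c ≡ c'
  one-bad {c} {c'} ¬good ¬good' with c Fin.≟ c'
  ... | yes c≡c' = c≡c'
  ... | no c≢c' = ⊥-elim (<-irrefl refl (begin-strict
    suc (m + m)                 <⟨ ≤-reflexive (cong suc (sym (+-suc m m))) ⟩
    suc m + suc m               ≤⟨ +-mono-≤ (proj₂ (bad c ¬good)) (proj₂ (bad c' ¬good')) ⟩
    (E c + O c) + (E c' + O c') ≤⟨ EO-pair c≢c' c≢c' ⟩
    suc (m + m)                 ∎))
    where open ≤-Reasoning

  -- Good copies c and c + 1 are joined by a crossing edge with both ends
  -- alive: at most m + m < 4^m tails are blocked.
  bridge : ∀ c → Good c → Good (inc4 c) →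
           Σ (Word m) λ r → d (false , c ∷ r) ≡ false × d (true , inc4 c ∷ r) ≡ false
  bridge c good good' with find-false (λ r → d (false , c ∷ r) ∨ d (true , inc4 c ∷ r)) (words m)
  ... | inj₁ (r , _ , both) = r , ∨-false both
  ... | inj₂ all-blocked = ⊥-elim (<⇒≱ (words-large m) (begin
    length (words m)                                                   ≤⟨ all-blocked ⟩
    count (λ r → d (false , c ∷ r) ∨ d (true , inc4 c ∷ r)) (words m) ≤⟨ count-∨ _ _ (words m) ⟩
    E c + O (inc4 c)                              ≤⟨ +-mono-≤ (proj₁ good) (proj₁ (proj₂ good')) ⟩
    m + m                                                              ∎))
    where open ≤-Reasoning

  some-alive : ∀ c → Good c → Σ (QV m) λ X → copy c d X ≡ false
  some-alive c good with find-false (λ r → d (false , c ∷ r)) (words m)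
  ... | inj₁ (r , _ , a) = (false , r) , a
  ... | inj₂ all-dead = ⊥-elim (<⇒≱ (words-large m)
          (≤-trans all-dead (≤-trans (proj₁ good) (m≤m+n m m))))

  within : ∀ c → Good c → ∀ X Y → copy c d X ≡ false → copy c d Y ≡ false →
           QPath d (embed c X) (embed c Y)
  within c good X Y a b = embed-path c d (IH (copy c d) good X Y a b)

  next : ∀ c c' → inc4 c ≡ c' → Good c → Good c' → ∀ X Y →
         copy c d X ≡ false → copy c' d Y ≡ false → QPath d (embed c X) (embed c' Y)
  next c _ refl good good' X Y a b with bridge c good good'
  ... | r , ar , ar' = QPath-trans d (within c good X (false , r) a ar)
                         (move ar (cross c) (within (inc4 c) good' (true , r) Y ar' b))

  -- Any two living vertices of good copies are joined: copies c and c + 2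
  -- are linked through whichever of c + 1, c - 1 is good.
  between-good : ∀ c c' → Good c → Good c' → ∀ X Y → copy c d X ≡ false → copy c' d Y ≡ false →
                 QPath d (embed c X) (embed c' Y)
  between-good c c' good good' X Y a b with position c c'
  ... | inj₁ refl = within c good X Y a b
  ... | inj₂ (inj₁ refl) = next c c' refl good good' X Y a b
  ... | inj₂ (inj₂ (inj₂ refl)) = QPath-sym d (next c' c (inc-dec c) good' good Y X b a)
  ... | inj₂ (inj₂ (inj₁ refl)) with sparse? m (copy (inc4 c) d) | sparse? m (copy (dec4 c) d)
  ...   | yes good₁ | _ = let Z , aZ = some-alive (inc4 c) good₁ in
    QPath-trans d (next c _ refl good good₁ X Z a aZ) (next (inc4 c) c' refl good₁ good' Z Y aZ b)
  ...   | no _ | yes good₃ = let Z , aZ = some-alive (dec4 c) good₃ in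
    QPath-sym d (QPath-trans d (next c' (dec4 c) (inc³≡dec c) good' good₃ Y Z b aZ)
                                (next (dec4 c) c (inc-dec c) good₃ good Z X aZ a))
  ...   | no ¬good₁ | no ¬good₃ = ⊥-elim (inc≢dec c (one-bad ¬good₁ ¬good₃))

  -- Counting cores of the escape lemmas: a bad copy cannot have all of the
  -- m + 1 escape routes of a living vertex blocked.
  trapped-even : ∀ c → ¬ Good c → 1 ≤ O (inc4 c) → suc m ≤ O c + E (dec4 c) → ⊥
  trapped-even c ¬good 1≤O⁺ blocked = no-room O-full 1≤O⁺ (O-pair (c≢c+1 c))
    where
    O-full : suc m ≤ O c
    O-full with proj₁ (bad c ¬good)
    ... | inj₁ E-full = drop-zero blocked (+-≤-zero E-full (E-pair (c≢c-1 c)))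
    ... | inj₂ (inj₁ O-full) = O-full
    ... | inj₂ (inj₂ few) =
      drop-zero blocked (+-≤-zero 1≤O⁺ (≤-trans (≤-reflexive (+-comm (O (inc4 c)) (E (dec4 c)))) few))

  trapped-odd : ∀ c → ¬ Good c → 1 ≤ E (dec4 c) → suc m ≤ E c + O (inc4 c) → ⊥
  trapped-odd c ¬good 1≤E⁻ blocked = no-room E-full 1≤E⁻ (E-pair (c≢c-1 c))
    where
    E-full : suc m ≤ E c
    E-full with proj₁ (bad c ¬good)
    ... | inj₁ E-full = E-full
    ... | inj₂ (inj₁ O-full) = drop-zero blocked (+-≤-zero O-full (O-pair (c≢c+1 c)))
    ... | inj₂ (inj₂ few) = drop-zero blocked (+-≤-zero 1≤E⁻ few)

  star-even : ∀ c {r s : Word m} → s ∈ star inc4 r → QAdj (false , c ∷ r) (true , c ∷ s)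
  star-even c (here refl) = flat
  star-even c {r} (there s∈) with ∈-map⁻ (λ i → updateAt r i inc4) s∈
  ... | i , _ , refl = shift (suc i)

  star-odd : ∀ c {r s : Word m} → s ∈ star dec4 r → QAdj (true , c ∷ r) (false , c ∷ s)
  star-odd c (here refl) = flat˘
  star-odd c {r} (there s∈) with ∈-map⁻ (λ i → updateAt r i dec4) s∈
  ... | i , _ , refl = subst (λ x → QAdj (true , c ∷ x) (false , c ∷ updateAt r i dec4))
                             (updateAt-inverse inc-dec r i) (shift˘ (suc i))

  count-star : ∀ (g : Word m → Bool) f → (∀ a → f a ≢ a) → ∀ r → count g (star f r) ≤ count g (words m)
  count-star g f nofix r = count-embed g g (star-unique f nofix r) (λ {x} _ gx → ∈-words x , gx)

  Escape : Fin 4 → QV m → Set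
  Escape c X = Σ (Fin 4) λ c₁ → c₁ ≢ c ×
               Σ (QV m) λ X₁ → copy c₁ d X₁ ≡ false × QPath d (embed c X) (embed c₁ X₁)

  -- A living even vertex (false , c ∷ r) of a bad copy escapes directly to
  -- copy c + 1, or through one of its m + 1 odd neighbours (true , c ∷ s)
  -- to (false , c - 1 ∷ s).
  escape-even : ∀ c → ¬ Good c → ∀ r → d (false , c ∷ r) ≡ false → Escape c (false , r)
  escape-even c ¬good r a with d (true , inc4 c ∷ r) in a⁺
  ... | false = inc4 c , inc-nofix c , (true , r) , a⁺ , move a (cross c) (stop a⁺)
  ... | true with find-false (λ s → d (true , c ∷ s) ∨ d (false , dec4 c ∷ s)) (star inc4 r)
  ...   | inj₁ (s , s∈ , both) = let as , as⁻ = ∨-false both in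
    dec4 c , dec-nofix c , (false , s) , as⁻ , move a (star-even c s∈) (move as (cross˘ c) (stop as⁻))
  ...   | inj₂ all-blocked = ⊥-elim (trapped-even c ¬good
            (count-pos (λ x → d (true , inc4 c ∷ x)) (words m) (∈-words r) a⁺) blocked)
    where
    open ≤-Reasoning
    blocked : suc m ≤ O c + E (dec4 c)
    blocked = begin
      suc m                ≡⟨ sym (length-star inc4 r) ⟩
      length (star inc4 r) ≤⟨ all-blocked ⟩
      count (λ s → d (true , c ∷ s) ∨ d (false , dec4 c ∷ s)) (star inc4 r)
        ≤⟨ count-∨ (λ s → d (true , c ∷ s)) (λ s → d (false , dec4 c ∷ s)) (star inc4 r) ⟩
      count (λ s → d (true , c ∷ s)) (star inc4 r) + count (λ s → d (false , dec4 c ∷ s)) (star inc4 r)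
        ≤⟨ +-mono-≤ (count-star _ inc4 inc-nofix r) (count-star _ inc4 inc-nofix r) ⟩
      O c + E (dec4 c)     ∎

  escape-odd : ∀ c → ¬ Good c → ∀ r → d (true , c ∷ r) ≡ false → Escape c (true , r)
  escape-odd c ¬good r a with d (false , dec4 c ∷ r) in a⁻
  ... | false = dec4 c , dec-nofix c , (false , r) , a⁻ , move a (cross˘ c) (stop a⁻)
  ... | true with find-false (λ s → d (false , c ∷ s) ∨ d (true , inc4 c ∷ s)) (star dec4 r)
  ...   | inj₁ (s , s∈ , both) = let as , as⁺ = ∨-false both in
    inc4 c , inc-nofix c , (true , s) , as⁺ , move a (star-odd c s∈) (move as (cross c) (stop as⁺))
  ...   | inj₂ all-blocked = ⊥-elim (trapped-odd c ¬good
            (count-pos (λ x → d (false , dec4 c ∷ x)) (words m) (∈-words r) a⁻) blocked)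
    where
    open ≤-Reasoning
    blocked : suc m ≤ E c + O (inc4 c)
    blocked = begin
      suc m                ≡⟨ sym (length-star dec4 r) ⟩
      length (star dec4 r) ≤⟨ all-blocked ⟩
      count (λ s → d (false , c ∷ s) ∨ d (true , inc4 c ∷ s)) (star dec4 r)
        ≤⟨ count-∨ (λ s → d (false , c ∷ s)) (λ s → d (true , inc4 c ∷ s)) (star dec4 r) ⟩
      count (λ s → d (false , c ∷ s)) (star dec4 r) + count (λ s → d (true , inc4 c ∷ s)) (star dec4 r)
        ≤⟨ +-mono-≤ (count-star _ dec4 dec-nofix r) (count-star _ dec4 dec-nofix r) ⟩
      E c + O (inc4 c)     ∎

  to-good : ∀ c X → copy c d X ≡ false →
            Σ (Fin 4) λ c₁ → Good c₁ ×
            Σ (QV m) λ X₁ → copy c₁ d X₁ ≡ false × QPath d (embed c X) (embed c₁ X₁)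
  to-good c X a with sparse? m (copy c d)
  ... | yes good = c , good , X , a , stop a
  ... | no ¬good with escape X a
    where
    escape : ∀ X → copy c d X ≡ false → Escape c X
    escape (false , r) = escape-even c ¬good r
    escape (true , r) = escape-odd c ¬good r
  ...   | c₁ , c₁≢c , X₁ , a₁ , path with sparse? m (copy c₁ d)
  ...     | yes good₁ = c₁ , good₁ , X₁ , a₁ , path
  ...     | no ¬good₁ = ⊥-elim (c₁≢c (one-bad ¬good₁ ¬good))

  connected : Connected d
  connected (p , c ∷ r) (q , c' ∷ r') a b with to-good c (p , r) a | to-good c' (q , r') b
  ... | c₁ , good₁ , X₁ , a₁ , path₁ | c₂ , good₂ , X₂ , a₂ , path₂ =
    QPath-trans d path₁ (QPath-trans d (between-good c₁ c₂ good₁ good₂ X₁ X₂ a₁ a₂) (QPath-sym d path₂))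

quotient-connected : ∀ L d → Sparse L d → Connected d
quotient-connected zero d _ = Q₀-connected d
quotient-connected (suc m) d sparse = Step.connected (quotient-connected m) d sparse

par : Fin 4 → Bool
par zero  = false
par one   = true
par two   = false
par three = true

twin : Bool → Bool → Fin 4
twin false false = zero
twin false true  = two
twin true  false = one
twin true  true  = three

par-twin : ∀ p b → par (twin p b) ≡ p
par-twin false false = refl
par-twin false true  = refl
par-twin true  false = refl
par-twin true  true  = refl

twins-differ : ∀ p → twin p false ≢ twin p true
twins-differ false ()
twins-differ true ()

PM-parity : ∀ {a b} → PM a b → par b ≡ not (par a)
PM-parity {zero}  (inj₁ refl) = refl
PM-parity {zero}  (inj₂ refl) = refl
PM-parity {one}   (inj₁ refl) = refl
PM-parity {one}   (inj₂ refl) = refl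
PM-parity {two}   (inj₁ refl) = refl
PM-parity {two}   (inj₂ refl) = refl
PM-parity {three} (inj₁ refl) = refl
PM-parity {three} (inj₂ refl) = refl

parity-PM : ∀ a b → par b ≡ not (par a) → PM a b
parity-PM zero  one   _ = inj₁ refl
parity-PM zero  three _ = inj₂ refl
parity-PM one   zero  _ = inj₂ refl
parity-PM one   two   _ = inj₁ refl
parity-PM two   one   _ = inj₂ refl
parity-PM two   three _ = inj₁ refl
parity-PM three zero  _ = inj₁ refl
parity-PM three two   _ = inj₂ refl
parity-PM zero  zero  ()
parity-PM zero  two   ()
parity-PM one   one   ()
parity-PM one   three ()
parity-PM two   zero  ()
parity-PM two   two   ()
parity-PM three one   ()
parity-PM three three ()

twist-even : ∀ a → par a ≡ false → twist a ≡ inc4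
twist-even zero _ = refl
twist-even two  _ = refl
twist-even one   ()
twist-even three ()

twist-odd : ∀ a → par a ≡ true → twist a ≡ dec4
twist-odd one   _ = refl
twist-odd three _ = refl
twist-odd zero ()
twist-odd two  ()

vpar : ∀ {L} → Vertex (suc L) → Bool
vpar (a ∷ _) = par a

Adj-parity : ∀ {L} {u v : Vertex (suc L)} → Adj u v → vpar v ≡ not (vpar u)
Adj-parity (inner pm) = PM-parity pm
Adj-parity (outer i pm) = PM-parity pm

opposite : ∀ {a b p} → par a ≡ p → par b ≡ not p → par b ≡ not (par a)
opposite pa pb = trans pb (cong not (sym pa))

lift-adj : ∀ {L} {a b : Fin 4} {p q} {x y : Word L} → par a ≡ p → par b ≡ q →
           QAdj (p , x) (q , y) → Adj (a ∷ x) (b ∷ y)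
lift-adj {a = a} {b} pa pb flat = inner (parity-PM a b (opposite pa pb))
lift-adj {a = a} {b} {x = x} pa pb (shift i) =
  subst (λ f → Adj (a ∷ x) (b ∷ updateAt x i f)) (twist-even a pa)
        (outer i (parity-PM a b (opposite pa pb)))
lift-adj {a = a} {b} pa pb flat˘ = inner (parity-PM a b (opposite pa pb))
lift-adj {a = a} {b} {y = y} pa pb (shift˘ i) =
  subst (λ z → Adj (a ∷ updateAt y i inc4) (b ∷ z)) undo (outer i (parity-PM a b (opposite pa pb)))
  where
  undo : updateAt (updateAt y i inc4) i (twist a) ≡ y
  undo = trans (cong (updateAt (updateAt y i inc4) i) (twist-odd a pa)) (updateAt-inverse dec-inc y i)

_≟v_ : ∀ {n} (u v : Vertex n) → Dec (u ≡ v)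
_≟v_ = ≡-dec Fin._≟_

InSub? : ∀ {n} (v : Vertex n) (f : K12Sub n) → Dec (InSub v f)
InSub? v (k1 u) with v ≟v u
... | yes refl = yes in-k1
... | no v≢u = no λ { in-k1 → v≢u refl }
InSub? v (k2 u w _) with v ≟v u | v ≟v w
... | yes refl | _ = yes in-k2₁
... | no _ | yes refl = yes in-k2₂
... | no v≢u | no v≢w = no λ { in-k2₁ → v≢u refl ; in-k2₂ → v≢w refl }
InSub? v (k12 u w z _ _ _) with v ≟v u | v ≟v w | v ≟v z
... | yes refl | _ | _ = yes in-k12₁
... | no _ | yes refl | _ = yes in-k12₂
... | no _ | no _ | yes refl = yes in-k12₃
... | no v≢u | no v≢w | no v≢z = no λ { in-k12₁ → v≢u refl ; in-k12₂ → v≢w refl ; in-k12₃ → v≢z refl }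

Reach-trans : ∀ {n} {F : List (K12Sub n)} {u v w} → Reach F u v → Reach F v w → Reach F u w
Reach-trans (here _) q = q
Reach-trans (step a e p) q = step a e (Reach-trans p q)

module Deletion {L : ℕ} (F : List (K12Sub (suc L))) where

  deleted : Vertex (suc L) → Bool
  deleted v = does (any? (InSub? v) F)

  deleted-sound : ∀ v → deleted v ≡ true → InV v F
  deleted-sound v e with any? (InSub? v) F
  ... | yes v∈ = v∈

  deleted-false : ∀ v → deleted v ≡ false → ¬ InV v F
  deleted-false v e with any? (InSub? v) F
  ... | no v∉ = v∉

  deleted-complete : ∀ v → ¬ InV v F → deleted v ≡ false
  deleted-complete v v∉ with any? (InSub? v) F
  ... | yes v∈ = ⊥-elim (v∉ v∈)
  ... | no _ = refl

  dead-pattern : QV L → Bool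
  dead-pattern (p , x) = deleted (twin p false ∷ x) ∧ deleted (twin p true ∷ x)

  surviving-twin : ∀ p x → dead-pattern (p , x) ≡ false →
                   Σ (Fin 4) λ a → par a ≡ p × deleted (a ∷ x) ≡ false
  surviving-twin p x dead≡false with deleted (twin p false ∷ x) in e
  ... | false = twin p false , par-twin p false , e
  ... | true = twin p true , par-twin p true , dead≡false

  survivor-alive : ∀ a x → deleted (a ∷ x) ≡ false → dead-pattern (par a , x) ≡ false
  survivor-alive zero  x e rewrite e = refl
  survivor-alive one   x e rewrite e = refl
  survivor-alive two   x e rewrite e = Bool.∧-zeroʳ _
  survivor-alive three x e rewrite e = Bool.∧-zeroʳ _

  lift-walk : ∀ {a x Y b y} → deleted (a ∷ x) ≡ false → QAdj (par a , x) Y →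
              QPath dead-pattern Y (par b , y) → deleted (b ∷ y) ≡ false → Reach F (a ∷ x) (b ∷ y)
  lift-walk {a} {x} {b = b} {y} ua e (stop _) ub =
    step (deleted-false (a ∷ x) ua) (lift-adj refl refl e) (here (deleted-false (b ∷ y) ub))
  lift-walk {a} {x} ua e (move {X = p , x'} aY e' rest) ub with surviving-twin p x' aY
  ... | a' , refl , ua' = step (deleted-false (a ∷ x) ua) (lift-adj refl refl e) (lift-walk ua' e' rest ub)

  lift-across : ∀ {X Y} → QPath dead-pattern X Y → proj₁ X ≢ proj₁ Y →
                ∀ {a x b y} → X ≡ (par a , x) → Y ≡ (par b , y) →
                deleted (a ∷ x) ≡ false → deleted (b ∷ y) ≡ false → Reach F (a ∷ x) (b ∷ y)
  lift-across (stop _) X≢Y refl _ _ _ = ⊥-elim (X≢Y refl)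
  lift-across (move _ e rest) _ refl refl ua ub = lift-walk ua e rest ub

  not≢ : ∀ p → p ≢ not p
  not≢ false ()
  not≢ true ()

  lift-connected : Connected dead-pattern → (∀ p → Σ (Word L) λ x → dead-pattern (p , x) ≡ false) →
                   ∀ u v → ¬ InV u F → ¬ InV v F → Reach F u v
  lift-connected conn alive (a ∷ x) (b ∷ y) u∉ v∉ = join (par a Bool.≟ par b)
    where
    ua : deleted (a ∷ x) ≡ false
    ua = deleted-complete (a ∷ x) u∉
    ub : deleted (b ∷ y) ≡ false
    ub = deleted-complete (b ∷ y) v∉
    join : Dec (par a ≡ par b) → Reach F (a ∷ x) (b ∷ y)
    join (no pa≢pb) =
      lift-across (conn _ _ (survivor-alive a x ua) (survivor-alive b y ub)) pa≢pb refl refl ua ub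
    join (yes pa≡pb) with alive (not (par a))
    ... | z , az with surviving-twin (not (par a)) z az
    ...   | c , pc , uc = Reach-trans
      (lift-across (conn _ _ (survivor-alive a x ua) az) (not≢ (par a)) refl (cong (_, z) (sym pc)) ua uc)
      (lift-across (conn _ _ az (survivor-alive b y ub)) (λ e → not≢ (par a) (trans pa≡pb (sym e)))
                   (cong (_, z) (sym pc)) refl uc ub)

verts : ∀ {n} → K12Sub n → List (Vertex n)
verts (k1 u) = u ∷ []
verts (k2 u v _) = u ∷ v ∷ []
verts (k12 u v w _ _ _) = u ∷ v ∷ w ∷ []

InSub-verts : ∀ {n} {v : Vertex n} {f} → InSub v f → v ∈ verts f
InSub-verts in-k1 = here refl
InSub-verts in-k2₁ = here refl
InSub-verts in-k2₂ = there (here refl)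
InSub-verts in-k12₁ = here refl
InSub-verts in-k12₂ = there (here refl)
InSub-verts in-k12₃ = there (there (here refl))

InV-verts : ∀ {n} {v : Vertex n} (F : List (K12Sub n)) → InV v F → v ∈ concatMap verts F
InV-verts (f ∷ F) (here v∈f) = ∈-++⁺ˡ (InSub-verts v∈f)
InV-verts (f ∷ F) (there v∈F) = ∈-++⁺ʳ (verts f) (InV-verts F v∈F)

length-verts : ∀ {n} (F : List (K12Sub n)) → length (concatMap verts F) ≤ 3 * length F
length-verts [] = z≤n
length-verts (f ∷ F) = begin
  length (verts f ++ concatMap verts F)         ≡⟨ length-++ (verts f) ⟩
  length (verts f) + length (concatMap verts F) ≤⟨ +-mono-≤ (at-most-3 f) (length-verts F) ⟩
  3 + 3 * length F                              ≡⟨ sym (*-suc 3 (length F)) ⟩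
  3 * length (f ∷ F)                            ∎
  where
  open ≤-Reasoning
  at-most-3 : ∀ f → length (verts f) ≤ 3
  at-most-3 (k1 _) = s≤s z≤n
  at-most-3 (k2 _ _ _) = s≤s (s≤s z≤n)
  at-most-3 (k12 _ _ _ _ _ _) = ≤-refl

-- ... and at most two of each parity, since the centre of a K_{1,2} has the
-- parity opposite to that of its leaves.
hasParity : Bool → Bool → Bool
hasParity true q = q
hasParity false q = not q

ofParity : ∀ {L} → Bool → Vertex (suc L) → Bool
ofParity p (a ∷ _) = hasParity p (par a)

ofParity-Adj : ∀ {L} p {u v : Vertex (suc L)} → Adj u v → b2n (ofParity p u) + b2n (ofParity p v) ≤ 1
ofParity-Adj p {a ∷ _} {b ∷ _} e = one-of p (par a) (Adj-parity e)
  where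
  one-of : ∀ p q {q'} → q' ≡ not q → b2n (hasParity p q) + b2n (hasParity p q') ≤ 1
  one-of true  true  refl = ≤-refl
  one-of true  false refl = ≤-refl
  one-of false true  refl = ≤-refl
  one-of false false refl = ≤-refl

parity-verts : ∀ {L} p (F : List (K12Sub (suc L))) →
               count (ofParity p) (concatMap verts F) ≤ 2 * length F
parity-verts p [] = z≤n
parity-verts p (f ∷ F) = begin
  count (ofParity p) (verts f ++ concatMap verts F)               ≡⟨ count-++ (ofParity p) (verts f) _ ⟩
  count (ofParity p) (verts f) + count (ofParity p) (concatMap verts F)
                                                                   ≤⟨ +-mono-≤ (at-most-2 f) (parity-verts p F) ⟩
  2 + 2 * length F                                                 ≡⟨ sym (*-suc 2 (length F)) ⟩
  2 * length (f ∷ F)                                               ∎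
  where
  open ≤-Reasoning
  at-most-2 : ∀ f → count (ofParity p) (verts f) ≤ 2
  at-most-2 (k1 u) = ≤-trans (count≤length (ofParity p) (u ∷ [])) (s≤s z≤n)
  at-most-2 (k2 u v _) = count≤length (ofParity p) (u ∷ v ∷ [])
  at-most-2 (k12 u v w e _ _) = begin
    b2n (ofParity p u) + (b2n (ofParity p v) + (b2n (ofParity p w) + 0))
      ≡⟨ sym (+-assoc (b2n (ofParity p u)) _ _) ⟩
    (b2n (ofParity p u) + b2n (ofParity p v)) + (b2n (ofParity p w) + 0)
      ≤⟨ +-mono-≤ (ofParity-Adj p e) (+-mono-≤ (b2n≤1 (ofParity p w)) (z≤n {0})) ⟩
    2 ∎

halve : ∀ L t → 2 * t ≤ 3 * L → t ≤ slack L
halve L t 2t≤3L with t ≤? slack L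
... | yes t≤ = t≤
... | no t≰ = ⊥-elim (<⇒≱ (3L<2[1+slack] L) (≤-trans (*-monoʳ-≤ 2 (≰⇒> t≰)) 2t≤3L))
  where
  3L<2[1+slack] : ∀ L → 3 * L < 2 * suc (slack L)
  3L<2[1+slack] zero = s≤s z≤n
  3L<2[1+slack] (suc m) = ≤-trans (m≤m+n _ m) (≤-reflexive (ring m))
    where
    ring : ∀ m → suc (3 * suc m) + m ≡ 2 * suc (suc (m + m))
    ring = solve-∀

∧-≤ˡ : ∀ a b → b2n (a ∧ b) ≤ b2n a
∧-≤ˡ true b = b2n≤1 b
∧-≤ˡ false b = z≤n

∧-≤ʳ : ∀ a b → b2n (a ∧ b) ≤ b2n b
∧-≤ʳ true b = ≤-refl
∧-≤ʳ false b = z≤n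

hasParity-self : ∀ p → hasParity p p ≡ true
hasParity-self true = refl
hasParity-self false = refl

module SmallFamily {L : ℕ} (F : List (K12Sub (suc L))) (few : length F ≤ L) where
  open Deletion F

  deletedAt : Fin 4 → ℕ
  deletedAt a = count (λ x → deleted (a ∷ x)) (words L)

  class-bound : ∀ p → deletedAt (twin p false) + deletedAt (twin p true) ≤ 2 * length F
  class-bound p = begin
    deletedAt a + deletedAt b                           ≡⟨ sym (count-blocks deleted a b) ⟩
    count deleted (map (a ∷_) (words L) ++ map (b ∷_) (words L))
      ≤⟨ count-embed deleted (ofParity p) (blocks-unique (twins-differ p)) member ⟩
    count (ofParity p) (concatMap verts F)              ≤⟨ parity-verts p F ⟩
    2 * length F                                        ∎
    where
    open ≤-Reasoning
    a = twin p false
    b = twin p true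
    twin-parity : ∀ c {x : Word L} → par c ≡ p → ofParity p (c ∷ x) ≡ true
    twin-parity c refl = hasParity-self (par c)
    block-parity : ∀ {v} → v ∈ map (a ∷_) (words L) ++ map (b ∷_) (words L) → ofParity p v ≡ true
    block-parity v∈ with ∈-++⁻ (map (a ∷_) (words L)) v∈
    ... | inj₁ v∈a with ∈-map⁻ (a ∷_) v∈a
    ...   | x , _ , refl = twin-parity a {x} (par-twin p false)
    block-parity v∈ | inj₂ v∈b with ∈-map⁻ (b ∷_) v∈b
    ...   | x , _ , refl = twin-parity b {x} (par-twin p true)
    member : ∀ {v} → v ∈ map (a ∷_) (words L) ++ map (b ∷_) (words L) → deleted v ≡ true →
             v ∈ concatMap verts F × ofParity p v ≡ true
    member {v} v∈ del = InV-verts F (deleted-sound v del) , block-parity v∈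

  total-bound : (deletedAt zero + deletedAt two) + (deletedAt one + deletedAt three) ≤ 3 * length F
  total-bound = begin
    (deletedAt zero + deletedAt two) + (deletedAt one + deletedAt three)
      ≡⟨ ring (deletedAt zero) (deletedAt one) (deletedAt two) (deletedAt three) ⟩
    sum (map deletedAt (allFin 4))          ≡⟨ sym (count-words-suc deleted) ⟩
    count deleted (words (suc L))
      ≤⟨ count-embed deleted (λ _ → true) (words-unique (suc L))
                     (λ {v} _ del → InV-verts F (deleted-sound v del) , refl) ⟩
    count (λ _ → true) (concatMap verts F)  ≤⟨ count≤length _ (concatMap verts F) ⟩
    length (concatMap verts F)              ≤⟨ length-verts F ⟩
    3 * length F                            ∎
    where
    open ≤-Reasoning
    ring : ∀ a b c d → (a + c) + (b + d) ≡ a + (b + (c + (d + 0)))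
    ring = solve-∀

  -- Both twins of a dead quotient vertex are deleted.
  twice-dead : ∀ p → 2 * dead p dead-pattern ≤ deletedAt (twin p false) + deletedAt (twin p true)
  twice-dead p = +-mono-≤
    (count-mono both left (λ x → ∧-≤ˡ (left x) (right x)) (words L))
    (≤-trans (≤-reflexive (+-identityʳ _)) (count-mono both right (λ x → ∧-≤ʳ (left x) (right x)) (words L)))
    where
    left right both : Word L → Bool
    left x = deleted (twin p false ∷ x)
    right x = deleted (twin p true ∷ x)
    both x = dead-pattern (p , x)

  dead-class : ∀ p → dead p dead-pattern ≤ L
  dead-class p = *-cancelˡ-≤ 2 (≤-trans (twice-dead p) (≤-trans (class-bound p) (*-monoʳ-≤ 2 few)))

  sparse : Sparse L dead-pattern
  sparse = dead-class false , dead-class true , halve L _ (begin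
    2 * (E + O)                 ≡⟨ *-distribˡ-+ 2 E O ⟩
    2 * E + 2 * O               ≤⟨ +-mono-≤ (twice-dead false) (twice-dead true) ⟩
    (deletedAt zero + deletedAt two) + (deletedAt one + deletedAt three) ≤⟨ total-bound ⟩
    3 * length F                ≤⟨ *-monoʳ-≤ 3 few ⟩
    3 * L                       ∎)
    where
    open ≤-Reasoning
    E = dead false dead-pattern
    O = dead true dead-pattern

  -- Each parity class keeps a living quotient vertex: at most L < 4^L die.
  class-alive : ∀ p → Σ (Word L) λ x → dead-pattern (p , x) ≡ false
  class-alive p with find-false (λ x → dead-pattern (p , x)) (words L)
  ... | inj₁ (x , _ , alive) = x , alive
  ... | inj₂ all-dead = ⊥-elim (<⇒≱ (words-large L)
          (≤-trans all-dead (≤-trans (dead-class p) (m≤m+n L L))))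

  not-cut : ¬ IsK12Cut F
  not-cut (inj₁ (u , v , u∉ , v∉ , ¬reach)) =
    ¬reach (lift-connected (quotient-connected L dead-pattern sparse) class-alive u v u∉ v∉)
  not-cut (inj₂ (u , _ , only-u)) with class-alive false | class-alive true
  ... | x₀ , a₀ | x₁ , a₁ with surviving-twin false x₀ a₀ | surviving-twin true x₁ a₁
  ...   | c₀ , p₀ , u₀ | c₁ , p₁ , u₁ = false≢true (trans (sym p₀) (trans (cong par same-head) p₁))
    where
    same-head : c₀ ≡ c₁
    same-head = ∷-injectiveˡ (trans (only-u _ (deleted-false _ u₀)) (sym (only-u _ (deleted-false _ u₁))))
    false≢true : false ≢ true
    false≢true ()

lower-bound : ∀ L (F : List (K12Sub (suc L))) → IsK12Cut F → suc L ≤ length F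
lower-bound L F cut with suc L ≤? length F
... | yes enough = enough
... | no ¬enough = ⊥-elim (SmallFamily.not-cut F (≤-pred (≰⇒> ¬enough)) cut)

-- Upper bound for n = L + 1 ≥ 2: the neighbours of o = (0, 0, …, 0) are the
-- vertices (±1, x) with x in star inc4 0; the n paths (1,x) - (2,x) - (3,x)
-- cover them and separate o from the surviving vertex (0, e₁).
module Isolation (L : ℕ) where

  zeros : Word (suc L)
  zeros = replicate (suc L) zero

  path : Word (suc L) → K12Sub (suc (suc L))
  path x = k12 (one ∷ x) (two ∷ x) (three ∷ x) (inner (inj₁ refl)) (inner (inj₁ refl)) (λ ())

  cut : List (K12Sub (suc (suc L)))
  cut = map path (star inc4 zeros)

  length-cut : length cut ≡ suc (suc L)
  length-cut = trans (length-map path (star inc4 zeros)) (length-star inc4 zeros)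

  head-0-survives : ∀ x xs → ¬ InV (zero ∷ x) (map path xs)
  head-0-survives x (_ ∷ xs) (here ())
  head-0-survives x (_ ∷ xs) (there v∈) = head-0-survives x xs v∈

  on-path : ∀ {v x} xs → x ∈ xs → InSub v (path x) → InV v (map path xs)
  on-path (_ ∷ xs) (here refl) v∈ = here v∈
  on-path (_ ∷ xs) (there x∈) v∈ = there (on-path xs x∈ v∈)

  pm-on-path : ∀ b x → PM zero b → InSub (b ∷ x) (path x)
  pm-on-path _ x (inj₁ refl) = in-k12₁
  pm-on-path _ x (inj₂ refl) = in-k12₃

  neighbour-deleted : ∀ {w} → Adj (zero ∷ zeros) w → InV w cut
  neighbour-deleted (inner {b = b} pm) = here (pm-on-path b zeros pm)
  neighbour-deleted (outer {b = b} i pm) =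
    on-path (star inc4 zeros) (there (∈-map⁺ (λ i → updateAt zeros i inc4) (∈-allFin i))) (pm-on-path b _ pm)

  Reach-start : ∀ {F : List (K12Sub (suc (suc L)))} {u v} → Reach F u v → ¬ InV u F
  Reach-start (here u∉) = u∉
  Reach-start (step u∉ _ _) = u∉

  isolated : ¬ Reach cut (zero ∷ zeros) (zero ∷ updateAt zeros zero inc4)
  isolated (step _ e rest) = Reach-start rest (neighbour-deleted e)

  is-cut : IsK12Cut cut
  is-cut = inj₁ (zero ∷ zeros , zero ∷ updateAt zeros zero inc4 ,
                 head-0-survives zeros (star inc4 zeros) ,
                 head-0-survives (updateAt zeros zero inc4) (star inc4 zeros) , isolated)

theorem4 : ∀ (n : ℕ) → 2 ≤ n → KappaS-K12-BH n n
theorem4 (suc (suc L)) (s≤s (s≤s z≤n)) =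
  (Isolation.cut L , Isolation.is-cut L , Isolation.length-cut L) , lower-bound (suc L)
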